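{- Let $m,d\ge 1$ be integers and let $H$ be a graph on $h\ge 4m$ vertices satisfying: 1. $\delta(H)\ge 2$; 2. no vertex $v$ with $d(v)<d$ is contained in a cycle of length $3$ or $4$, and every two distinct vertices $u,v$ with $d(u),d(v)<d$ are at distance at least $5$ in $H$; 3. every set $U\subseteq V(H)$ with $|U|\le 5m$ spans at most $d|U|/10$ edges; 4. there is an edge between every pair of disjoint sets $U_1,U_2\subseteq V(H)$ with $|U_1|=|U_2|=m$. Then $H$ is an $(h/4,2)$-expander.
   Context: Degrees $d(v)$ are in $H$. A graph $H$ is a $(k,\alpha)$-expander if $|N(U)|\ge\alpha|U|$ for every vertex set $U$ with $|U|\le k$, where $N(U)$ is the set of vertices outside $U$ adjacent to some vertex of $U$. -}

module Defs where

open import Data.Nat using (ℕ; zero; suc; _+_; _*_; _≤_; _<_)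
open import Data.Bool using (Bool; true; false; _∧_; not; if_then_else_)
open import Data.Fin using (Fin; toℕ)
open import Data.Fin.Subset using (Subset; _∈_; _∉_; ∣_∣)
open import Data.Vec using (Vec; tabulate; lookup)
open import Data.List using (List; map)
open import Data.Nat.ListAction using (sum)
open import Data.Bool.ListAction using (any)
open import Data.List using () renaming (allFin to allFinL)
open import Data.Product using (Σ; ∃; ∃-syntax; _×_; _,_)
open import Relation.Nullary using (¬_; Dec; yes; no)
open import Relation.Nullary.Decidable using (⌊_⌋)
open import Relation.Binary.PropositionalEquality using (_≡_; _≢_)
import Data.Fin as F

record Graph (n : ℕ) : Set where
  field
    adj    : Fin n → Fin n → Bool
    sym    : ∀ u v → adj u v ≡ adj v u
    irrefl : ∀ v → adj v v ≡ false
open Graph public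

module _ {n : ℕ} (G : Graph n) where

  Adj : Fin n → Fin n → Set
  Adj u v = adj G u v ≡ true

  nbrs : Fin n → Subset n
  nbrs v = tabulate (λ u → adj G v u)

  deg : Fin n → ℕ
  deg v = ∣ nbrs v ∣

  MinDegAtLeast : ℕ → Set
  MinDegAtLeast k = ∀ v → k ≤ deg v

  -- external neighbourhood N(U): vertices outside U adjacent to some vertex of U
  N : Subset n → Subset n
  N U = tabulate (λ u → not (lookup U u) ∧ any (λ w → lookup U w ∧ adj G w u) (allFinL n))

  -- e(U): number of edges spanned by U (unordered pairs {u,v} ⊆ U, counted once via toℕ u < toℕ v)
  e : Subset n → ℕ
  e U = sum (map (λ u → sum (map (λ v →
          if lookup U u ∧ lookup U v ∧ adj G u v ∧ ⌊ toℕ u Data.Nat.<? toℕ v ⌋ then 1 else 0)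
          (allFinL n))) (allFinL n))
    where import Data.Nat

  OnTriangle : Fin n → Set
  OnTriangle v = ∃[ a ] ∃[ b ] (Adj v a × Adj a b × Adj b v)

  -- v lies on a cycle of length 4: v a b c pairwise distinct, v~a~b~c~v
  OnC4 : Fin n → Set
  OnC4 v = ∃[ a ] ∃[ b ] ∃[ c ]
    (Adj v a × Adj a b × Adj b c × Adj c v × v ≢ b × a ≢ c)

  data Walk : ℕ → Fin n → Fin n → Set where
    here : ∀ {v} → Walk zero v v
    step : ∀ {k u w v} → Adj u w → Walk k w v → Walk (suc k) u v

  -- dist(u,v) ≥ k  (no walk, equivalently no path, of length < k)
  DistAtLeast : ℕ → Fin n → Fin n → Set
  DistAtLeast k u v = ∀ j → j < k → ¬ Walk j u v

  -- (k,α)-expander, with the bound |U| ≤ k given as a rational k = p/q via q|U| ≤ p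
  -- IsExpander p q α : every U with q·|U| ≤ p has |N(U)| ≥ α|U|
  IsExpander : (p q α : ℕ) → Set
  IsExpander p q α = ∀ (U : Subset n) → q * ∣ U ∣ ≤ p → α * ∣ U ∣ ≤ ∣ N U ∣

module Submission where

open import Defs
open import Data.Nat using (ℕ; _+_; _*_; _≤_; _<_)
open import Data.Fin using (Fin)
open import Data.Fin.Subset using (Subset; _∈_; _∉_; ∣_∣)
open import Data.Product using (_×_; ∃-syntax)
open import Relation.Nullary using (¬_)
open import Relation.Binary.PropositionalEquality using (_≢_; _≡_)

-- Suppose |N(U)| < 2|U| and let X = U ∪ N(U).  If |U| ≥ m, more than m vertices lie outside X,
-- and (4) gives an edge from U to one of them, which would then lie in N(U).  If |U| < m, then
-- |X| < 3|U| ≤ 5m and (3) bounds Σ_{x∈X} deg_X(x) = 2e(X) ≤ d|X|/5.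
--   d ≤ 5: vertices of U have their ≥ 2 neighbours in X and vertices of N(U) have one there,
--          so 2e(X) ≥ 2|U| + |N(U)|, which is too large.
--   d > 5: split U into its low part L and high part B and let Y = B ∪ (N(U) ∖ N(L)).  The
--          vertices of L have disjoint sets of ≥ 2 neighbours, whence |N(L)| ≥ 2|L| and
--          |Y| < 4|B|; a vertex of B has at most one neighbour outside Y, whence
--          2e(Y) ≥ (d − 1)|B|; this contradicts 10e(Y) ≤ d|Y|.

open import Data.Nat using (zero; suc; z≤n; s≤s; _∸_; _<?_; _≤?_)
import Data.Nat.Properties as ℕ
open import Data.Nat.Tactic.RingSolver using (solve-∀)
import Data.Nat.ListAction as ListSum
open import Data.Bool using (Bool; true; false; T; _∧_; _∨_; not; if_then_else_)
open import Data.Bool.Properties using (T-≡; T-∧)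
import Data.Fin as Fin
open import Data.Fin using (toℕ)
open import Data.Fin.Properties using (toℕ-injective; suc-injective)
open import Data.Fin.Subset using (_∪_; _∩_; ∁; _⊆_; inside; outside) renaming (⊥ to ∅)
open import Data.Fin.Subset.Properties
  using ( _∈?_; p⊆q⇒∣p∣≤∣q∣; Empty-unique; ∉⊥; ∣⊥∣≡0; ∣⁅x⁆∣≡1; x∈⁅y⁆⇒x≡y; ∣∁p∣≡n∸∣p∣
        ; x∈p∩q⁺; x∈p∩q⁻; x∈p∪q⁺; x∈p∪q⁻; x∉p⇒x∈∁p; x∈∁p⇒x∉p )
open import Data.Vec using ([]; _∷_; lookup; tabulate; here; there)
import Data.Vec.Properties as Vec
import Data.List as List
open import Data.List.Relation.Unary.Any using (Any; satisfied)
open import Data.List.Relation.Unary.Any.Properties using (any⁺; any⁻)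
open import Data.List.Membership.Propositional using (lose)
open import Data.List.Membership.Propositional.Properties using (∈-allFin)
open import Data.Product using (_,_; proj₁; proj₂)
open import Data.Sum using (_⊎_; inj₁; inj₂)
import Data.Sum as Sum
open import Data.Empty using (⊥; ⊥-elim)
open import Function using (_∘_; id; case_of_)
open import Function.Bundles using (module Equivalence)
open Equivalence using (to; from)
open import Relation.Nullary using (yes; no)
open import Relation.Nullary.Decidable using (⌊_⌋; True; toWitness; fromWitness)
import Relation.Binary.PropositionalEquality as ≡
open import Relation.Binary.PropositionalEquality using (refl; trans; cong; cong₂; subst; module ≡-Reasoning)
open import Algebra.Properties.Semiring.Sum ℕ.+-*-semiring
  using (sum; sum-cong-≗; ∑-distrib-+; ∑-comm; *-distribˡ-sum)

𝟙 : Bool → ℕ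
𝟙 b = if b then 1 else 0

𝟙-∧ : ∀ a b → 𝟙 (a ∧ b) ≡ 𝟙 a * 𝟙 b
𝟙-∧ true  b = ≡.sym (ℕ.+-identityʳ (𝟙 b))
𝟙-∧ false b = refl

∧-swap : ∀ a b c → a ∧ b ∧ c ≡ b ∧ a ∧ c
∧-swap true  b     c = refl
∧-swap false true  c = refl
∧-swap false false c = refl

-- Of two adjacent vertices exactly one comes first; this orients each edge once.
𝟙-orient : ∀ a b r s t → (r ≡ true → 𝟙 s + 𝟙 t ≡ 1) →
           𝟙 (a ∧ b ∧ r ∧ s) + 𝟙 (b ∧ a ∧ r ∧ t) ≡ 𝟙 (a ∧ b ∧ r)
𝟙-orient true  true  true  s t one = one refl
𝟙-orient true  true  false s t _   = refl
𝟙-orient true  false r     s t _   = refl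
𝟙-orient false true  r     s t _   = refl
𝟙-orient false false r     s t _   = refl

<-exactlyOne : ∀ i j → i ≢ j → 𝟙 ⌊ i <? j ⌋ + 𝟙 ⌊ j <? i ⌋ ≡ 1
<-exactlyOne i j i≢j with i <? j | j <? i
... | yes i<j | yes j<i = ⊥-elim (ℕ.<-asym i<j j<i)
... | yes _   | no  _   = refl
... | no  _   | yes _   = refl
... | no  i≮j | no  j≮i = ⊥-elim (i≢j (ℕ.≤-antisym (ℕ.≮⇒≥ j≮i) (ℕ.≮⇒≥ i≮j)))

sum-mono : ∀ {n} {f g : Fin n → ℕ} → (∀ i → f i ≤ g i) → sum f ≤ sum g
sum-mono {zero}  f≤g = z≤n
sum-mono {suc n} f≤g = ℕ.+-mono-≤ (f≤g Fin.zero) (sum-mono (λ i → f≤g (Fin.suc i)))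


listSum-allFin : ∀ {n} (f : Fin n → ℕ) → ListSum.sum (List.map f (List.allFin n)) ≡ sum f
listSum-allFin f = go id f
  where
  go : ∀ {n} {A : Set} (g : Fin n → A) (f : A → ℕ) → ListSum.sum (List.map f (List.tabulate g)) ≡ sum (f ∘ g)
  go {zero}  g f = refl
  go {suc n} g f = cong (f (g Fin.zero) +_) (go (g ∘ Fin.suc) f)

∣p∣≡∑𝟙 : ∀ {n} (p : Subset n) → ∣ p ∣ ≡ sum (λ x → 𝟙 (lookup p x))
∣p∣≡∑𝟙 []            = refl
∣p∣≡∑𝟙 (inside  ∷ p) = cong suc (∣p∣≡∑𝟙 p)
∣p∣≡∑𝟙 (outside ∷ p) = ∣p∣≡∑𝟙 p

∣p∪q∣+∣p∩q∣≡∣p∣+∣q∣ : ∀ {n} (p q : Subset n) → ∣ p ∪ q ∣ + ∣ p ∩ q ∣ ≡ ∣ p ∣ + ∣ q ∣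
∣p∪q∣+∣p∩q∣≡∣p∣+∣q∣ []            []            = refl
∣p∪q∣+∣p∩q∣≡∣p∣+∣q∣ (inside  ∷ p) (inside  ∷ q) =
  cong suc (trans (ℕ.+-suc _ _) (trans (cong suc (∣p∪q∣+∣p∩q∣≡∣p∣+∣q∣ p q)) (≡.sym (ℕ.+-suc _ _))))
∣p∪q∣+∣p∩q∣≡∣p∣+∣q∣ (inside  ∷ p) (outside ∷ q) = cong suc (∣p∪q∣+∣p∩q∣≡∣p∣+∣q∣ p q)
∣p∪q∣+∣p∩q∣≡∣p∣+∣q∣ (outside ∷ p) (inside  ∷ q) =
  trans (cong suc (∣p∪q∣+∣p∩q∣≡∣p∣+∣q∣ p q)) (≡.sym (ℕ.+-suc _ _))
∣p∪q∣+∣p∩q∣≡∣p∣+∣q∣ (outside ∷ p) (outside ∷ q) = ∣p∪q∣+∣p∩q∣≡∣p∣+∣q∣ p q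

∣p∪q∣≤∣p∣+∣q∣ : ∀ {n} (p q : Subset n) → ∣ p ∪ q ∣ ≤ ∣ p ∣ + ∣ q ∣
∣p∪q∣≤∣p∣+∣q∣ p q = subst (∣ p ∪ q ∣ ≤_) (∣p∪q∣+∣p∩q∣≡∣p∣+∣q∣ p q) (ℕ.m≤m+n _ _)

Disjoint : ∀ {n} → Subset n → Subset n → Set
Disjoint p q = ∀ {x} → x ∈ p → x ∉ q

∣p∪q∣≡∣p∣+∣q∣ : ∀ {n} (p q : Subset n) → Disjoint p q → ∣ p ∪ q ∣ ≡ ∣ p ∣ + ∣ q ∣
∣p∪q∣≡∣p∣+∣q∣ {n} p q p#q = begin
  ∣ p ∪ q ∣                ≡⟨ ≡.sym (ℕ.+-identityʳ _) ⟩
  ∣ p ∪ q ∣ + 0            ≡⟨ cong (∣ p ∪ q ∣ +_) (≡.sym ∣p∩q∣≡0) ⟩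
  ∣ p ∪ q ∣ + ∣ p ∩ q ∣    ≡⟨ ∣p∪q∣+∣p∩q∣≡∣p∣+∣q∣ p q ⟩
  ∣ p ∣ + ∣ q ∣            ∎
  where
  open ≡-Reasoning
  ∣p∩q∣≡0 : ∣ p ∩ q ∣ ≡ 0
  ∣p∩q∣≡0 = trans (cong ∣_∣ (Empty-unique λ (x , x∈p∩q) →
    let (x∈p , x∈q) = x∈p∩q⁻ p q x∈p∩q in p#q x∈p x∈q)) (∣⊥∣≡0 n)

∣p∩q∣+∣p∩∁q∣≡∣p∣ : ∀ {n} (p q : Subset n) → ∣ p ∩ q ∣ + ∣ p ∩ ∁ q ∣ ≡ ∣ p ∣
∣p∩q∣+∣p∩∁q∣≡∣p∣ []            []            = refl
∣p∩q∣+∣p∩∁q∣≡∣p∣ (inside  ∷ p) (inside  ∷ q) = cong suc (∣p∩q∣+∣p∩∁q∣≡∣p∣ p q)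
∣p∩q∣+∣p∩∁q∣≡∣p∣ (inside  ∷ p) (outside ∷ q) =
  trans (ℕ.+-suc _ _) (cong suc (∣p∩q∣+∣p∩∁q∣≡∣p∣ p q))
∣p∩q∣+∣p∩∁q∣≡∣p∣ (outside ∷ p) (inside  ∷ q) = ∣p∩q∣+∣p∩∁q∣≡∣p∣ p q
∣p∩q∣+∣p∩∁q∣≡∣p∣ (outside ∷ p) (outside ∷ q) = ∣p∩q∣+∣p∩∁q∣≡∣p∣ p q

x∈p⇒1≤∣p∣ : ∀ {n} {x : Fin n} {p : Subset n} → x ∈ p → 1 ≤ ∣ p ∣
x∈p⇒1≤∣p∣ {x = x} {p} x∈p = subst (_≤ ∣ p ∣) (∣⁅x⁆∣≡1 x)
  (p⊆q⇒∣p∣≤∣q∣ λ y∈⁅x⁆ → subst (_∈ p) (≡.sym (x∈⁅y⁆⇒x≡y x y∈⁅x⁆)) x∈p)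

∣p∣≤1 : ∀ {n} (p : Subset n) → (∀ {x y} → x ∈ p → y ∈ p → x ≡ y) → ∣ p ∣ ≤ 1
∣p∣≤1 []            _      = z≤n
∣p∣≤1 (outside ∷ p) unique = ∣p∣≤1 p λ x∈p y∈p → suc-injective (unique (there x∈p) (there y∈p))
∣p∣≤1 {suc n} (inside ∷ p) unique = s≤s (ℕ.≤-reflexive (trans (cong ∣_∣ p≡∅) (∣⊥∣≡0 n)))
  where
  p≡∅ : p ≡ ∅
  p≡∅ = Empty-unique λ (y , y∈p) → case unique here (there y∈p) of λ ()

subsetOfSize : ∀ {n} (p : Subset n) k → k ≤ ∣ p ∣ → ∃[ q ] (q ⊆ p × ∣ q ∣ ≡ k)
subsetOfSize {n} p zero _ = ∅ , (λ x∈∅ → ⊥-elim (∉⊥ x∈∅)) , ∣⊥∣≡0 n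
subsetOfSize (inside ∷ p)  (suc k) (s≤s k≤∣p∣) with subsetOfSize p k k≤∣p∣
... | q , q⊆p , ∣q∣≡k = inside ∷ q , (λ { here → here ; (there x∈q) → there (q⊆p x∈q) }) , cong suc ∣q∣≡k
subsetOfSize (outside ∷ p) (suc k) k≤∣p∣     with subsetOfSize p (suc k) k≤∣p∣
... | q , q⊆p , ∣q∣≡k = outside ∷ q , (λ { (there x∈q) → there (q⊆p x∈q) }) , ∣q∣≡k

∈-tabulate⁺ : ∀ {n} {f : Fin n → Bool} {x} → f x ≡ true → x ∈ tabulate f
∈-tabulate⁺ {f = f} {x} fx = Vec.lookup⇒[]= x (tabulate f) (trans (Vec.lookup∘tabulate f x) fx)

∈-tabulate⁻ : ∀ {n} {f : Fin n → Bool} {x} → x ∈ tabulate f → f x ≡ true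
∈-tabulate⁻ {f = f} {x} x∈ = trans (≡.sym (Vec.lookup∘tabulate f x)) (Vec.[]=⇒lookup x∈)

module _ {n : ℕ} (G : Graph n) where

  Adj-sym : ∀ {u v} → Adj G u v → Adj G v u
  Adj-sym {u} {v} uv = trans (Graph.sym G v u) uv

  Adj⇒≢ : ∀ {u v} → Adj G u v → u ≢ v
  Adj⇒≢ {u} uu refl = case trans (≡.sym uu) (irrefl G u) of λ ()

  ∈N⁺ : ∀ {U : Subset n} {w x} → w ∈ U → Adj G w x → x ∉ U → x ∈ N G U
  ∈N⁺ {U} {w} {x} w∈U wx x∉U = ∈-tabulate⁺ (T-≡ .to (T-∧ .from (x∉U′ , any⁺ _ wx′)))
    where
    x∉U′ : T (not (lookup U x))
    x∉U′ with lookup U x in eq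
    ... | true  = x∉U (Vec.lookup⇒[]= x U eq)
    ... | false = _
    wx′ : Any (λ v → T (lookup U v ∧ adj G v x)) (List.allFin n)
    wx′ = lose (∈-allFin w) (T-∧ .from (T-≡ .from (Vec.[]=⇒lookup w∈U) , T-≡ .from wx))

  ∈N⁻ : ∀ {U : Subset n} {x} → x ∈ N G U → x ∉ U × ∃[ w ] (w ∈ U × Adj G w x)
  ∈N⁻ {U} {x} x∈N =
    let (x∉U′ , some-wx) = T-∧ .to (T-≡ .from (∈-tabulate⁻ x∈N))
        (w , wx′)         = satisfied (any⁻ _ (List.allFin n) some-wx)
        (w∈U′ , wx)       = T-∧ .to wx′
    in (λ x∈U → subst (T ∘ not) (Vec.[]=⇒lookup x∈U) x∉U′) ,
       w , Vec.lookup⇒[]= w U (T-≡ .to w∈U′) , T-≡ .to wx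

  closedN : Subset n → Subset n
  closedN U = U ∪ N G U

  U#N : ∀ U → Disjoint U (N G U)
  U#N U x∈U x∈N = proj₁ (∈N⁻ x∈N) x∈U

  ∣closedN∣ : ∀ U → ∣ closedN U ∣ ≡ ∣ U ∣ + ∣ N G U ∣
  ∣closedN∣ U = ∣p∪q∣≡∣p∣+∣q∣ U (N G U) (U#N U)

  nbr∈closedN : ∀ {U x y} → x ∈ U → Adj G x y → y ∈ closedN U
  nbr∈closedN {U} {y = y} x∈U xy with y ∈? U
  ... | yes y∈U = x∈p∪q⁺ (inj₁ y∈U)
  ... | no  y∉U = x∈p∪q⁺ (inj₂ (∈N⁺ x∈U xy y∉U))

  degIn : Fin n → Subset n → ℕ
  degIn x B = ∣ B ∩ nbrs G x ∣

  ∈-nbrsIn⁻ : ∀ {x y} {B : Subset n} → y ∈ B ∩ nbrs G x → y ∈ B × Adj G x y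
  ∈-nbrsIn⁻ {B = B} y∈ = let (y∈B , y∈nbrs) = x∈p∩q⁻ B _ y∈ in y∈B , ∈-tabulate⁻ y∈nbrs

  ∈-nbrsIn⁺ : ∀ {x y} {B : Subset n} → y ∈ B → Adj G x y → y ∈ B ∩ nbrs G x
  ∈-nbrsIn⁺ y∈B xy = x∈p∩q⁺ (y∈B , ∈-tabulate⁺ xy)

  1≤degIn : ∀ {x y} {B : Subset n} → y ∈ B → Adj G x y → 1 ≤ degIn x B
  1≤degIn y∈B xy = x∈p⇒1≤∣p∣ (∈-nbrsIn⁺ y∈B xy)

  degIn≤1 : ∀ {x} {B : Subset n} → (∀ {y z} → y ∈ B → z ∈ B → Adj G x y → Adj G x z → y ≡ z) →
            degIn x B ≤ 1
  degIn≤1 {x} {B} unique = ∣p∣≤1 (B ∩ nbrs G x) λ y∈ z∈ →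
    let (y∈B , xy) = ∈-nbrsIn⁻ y∈ ; (z∈B , xz) = ∈-nbrsIn⁻ z∈ in unique y∈B z∈B xy xz

  deg≤degIn : ∀ {x} {B : Subset n} → (∀ {y} → Adj G x y → y ∈ B) → deg G x ≤ degIn x B
  deg≤degIn covered = p⊆q⇒∣p∣≤∣q∣ λ y∈nbrs → let xy = ∈-tabulate⁻ y∈nbrs in ∈-nbrsIn⁺ (covered xy) xy

  deg≤degIn+degIn : ∀ {x} {B C : Subset n} → (∀ {y} → Adj G x y → y ∈ B ⊎ y ∈ C) →
                    deg G x ≤ degIn x B + degIn x C
  deg≤degIn+degIn {x} {B} {C} covered =
    ℕ.≤-trans (p⊆q⇒∣p∣≤∣q∣ split) (∣p∪q∣≤∣p∣+∣q∣ (B ∩ nbrs G x) (C ∩ nbrs G x))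
    where
    split : nbrs G x ⊆ (B ∩ nbrs G x) ∪ (C ∩ nbrs G x)
    split {y} y∈nbrs = x∈p∪q⁺ (Sum.map (λ y∈B → ∈-nbrsIn⁺ y∈B xy) (λ y∈C → ∈-nbrsIn⁺ y∈C xy) (covered xy))
      where
      xy : Adj G x y
      xy = ∈-tabulate⁻ y∈nbrs

  E : Subset n → Subset n → ℕ
  E A B = sum λ x → 𝟙 (lookup A x) * degIn x B

  E-lower : ∀ k c {A B : Subset n} → (∀ {x} → x ∈ A → k ≤ c + degIn x B) →
            k * ∣ A ∣ ≤ c * ∣ A ∣ + E A B
  E-lower k c {A} {B} bound = begin
    k * ∣ A ∣                                    ≡⟨ cong (k *_) (∣p∣≡∑𝟙 A) ⟩
    k * sum (𝟙 ∘ lookup A)                       ≡⟨ *-distribˡ-sum {n} k _ ⟩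
    sum (λ x → k * 𝟙 (lookup A x))               ≤⟨ sum-mono (λ x → weigh (lookup A x) (bound ∘ lookup⇒∈ x)) ⟩
    sum (λ x → c * 𝟙 (lookup A x) + 𝟙 (lookup A x) * degIn x B)
                                                 ≡⟨ ∑-distrib-+ {n} _ _ ⟩
    sum (λ x → c * 𝟙 (lookup A x)) + E A B       ≡⟨ cong (_+ E A B) (≡.sym (*-distribˡ-sum {n} c _)) ⟩
    c * sum (𝟙 ∘ lookup A) + E A B               ≡⟨ cong (λ s → c * s + E A B) (≡.sym (∣p∣≡∑𝟙 A)) ⟩
    c * ∣ A ∣ + E A B                            ∎
    where
    open ℕ.≤-Reasoning
    lookup⇒∈ : ∀ x → lookup A x ≡ true → x ∈ A
    lookup⇒∈ x = Vec.lookup⇒[]= x A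
    weigh : ∀ a {t} → (a ≡ true → k ≤ c + t) → k * 𝟙 a ≤ c * 𝟙 a + 𝟙 a * t
    weigh true  {t} k≤c+t
      rewrite ℕ.*-identityʳ k | ℕ.*-identityʳ c | ℕ.+-identityʳ t = k≤c+t refl
    weigh false _ rewrite ℕ.*-zeroʳ k = z≤n

  E-upper : ∀ k {A B : Subset n} → (∀ {x} → x ∈ A → degIn x B ≤ k) → E A B ≤ k * ∣ A ∣
  E-upper k {A} {B} bound = begin
    E A B                             ≤⟨ sum-mono (λ x → weigh (lookup A x) (bound ∘ Vec.lookup⇒[]= x A)) ⟩
    sum (λ x → k * 𝟙 (lookup A x))    ≡⟨ ≡.sym (*-distribˡ-sum {n} k _) ⟩
    k * sum (𝟙 ∘ lookup A)            ≡⟨ cong (k *_) (≡.sym (∣p∣≡∑𝟙 A)) ⟩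
    k * ∣ A ∣                          ∎
    where
    open ℕ.≤-Reasoning
    weigh : ∀ a {t} → (a ≡ true → t ≤ k) → 𝟙 a * t ≤ k * 𝟙 a
    weigh true  {t} t≤k rewrite ℕ.*-identityʳ k | ℕ.+-identityʳ t = t≤k refl
    weigh false _ = z≤n

  E-monoˡ : ∀ {A A′ B : Subset n} → A ⊆ A′ → E A B ≤ E A′ B
  E-monoˡ {A} {A′} {B} A⊆A′ = sum-mono λ x → ℕ.*-monoˡ-≤ (degIn x B) (𝟙-mono x)
    where
    𝟙-mono : ∀ x → 𝟙 (lookup A x) ≤ 𝟙 (lookup A′ x)
    𝟙-mono x with lookup A x in eq
    ... | false = z≤n
    ... | true rewrite Vec.[]=⇒lookup (A⊆A′ (Vec.lookup⇒[]= x A eq)) = ℕ.≤-refl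

  E-∪ˡ : ∀ {A A′ : Subset n} B → Disjoint A A′ → E (A ∪ A′) B ≡ E A B + E A′ B
  E-∪ˡ {A} {A′} B A#A′ = trans (sum-cong-≗ λ x → split x) (∑-distrib-+ {n} _ _)
    where
    𝟙-∨ : ∀ x → 𝟙 (lookup (A ∪ A′) x) ≡ 𝟙 (lookup A x) + 𝟙 (lookup A′ x)
    𝟙-∨ x rewrite Vec.lookup-zipWith _∨_ x A A′ with lookup A x in eq | lookup A′ x in eq′
    ... | true  | true  = ⊥-elim (A#A′ (Vec.lookup⇒[]= x A eq) (Vec.lookup⇒[]= x A′ eq′))
    ... | true  | false = refl
    ... | false | _     = refl
    split : ∀ x → 𝟙 (lookup (A ∪ A′) x) * degIn x B ≡
                  𝟙 (lookup A x) * degIn x B + 𝟙 (lookup A′ x) * degIn x B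
    split x = trans (cong (_* degIn x B) (𝟙-∨ x)) (ℕ.*-distribʳ-+ (degIn x B) (𝟙 (lookup A x)) _)

  E-pairs : ∀ A B → E A B ≡ sum λ x → sum λ y → 𝟙 (lookup A x ∧ lookup B y ∧ adj G x y)
  E-pairs A B = sum-cong-≗ row
    where
    open ≡-Reasoning
    entry : ∀ x y → 𝟙 (lookup A x) * 𝟙 (lookup (B ∩ nbrs G x) y) ≡
                    𝟙 (lookup A x ∧ lookup B y ∧ adj G x y)
    entry x y rewrite Vec.lookup-zipWith _∧_ y B (nbrs G x) | Vec.lookup∘tabulate (adj G x) y =
      ≡.sym (𝟙-∧ (lookup A x) _)
    row : ∀ x → 𝟙 (lookup A x) * degIn x B ≡ sum (λ y → 𝟙 (lookup A x ∧ lookup B y ∧ adj G x y))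
    row x = begin
      𝟙 (lookup A x) * degIn x B                                  ≡⟨ cong (𝟙 (lookup A x) *_) (∣p∣≡∑𝟙 (B ∩ nbrs G x)) ⟩
      𝟙 (lookup A x) * sum (λ y → 𝟙 (lookup (B ∩ nbrs G x) y))   ≡⟨ *-distribˡ-sum {n} (𝟙 (lookup A x)) _ ⟩
      sum (λ y → 𝟙 (lookup A x) * 𝟙 (lookup (B ∩ nbrs G x) y))   ≡⟨ sum-cong-≗ (entry x) ⟩
      sum (λ y → 𝟙 (lookup A x ∧ lookup B y ∧ adj G x y))         ∎

  E-sym : ∀ A B → E A B ≡ E B A
  E-sym A B = begin
    E A B                                                      ≡⟨ E-pairs A B ⟩
    sum (λ x → sum λ y → 𝟙 (lookup A x ∧ lookup B y ∧ adj G x y)) ≡⟨ ∑-comm {n} {n} _ ⟩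
    sum (λ y → sum λ x → 𝟙 (lookup A x ∧ lookup B y ∧ adj G x y)) ≡⟨ sum-cong-≗ (λ y → sum-cong-≗ λ x → cong 𝟙 (swap x y)) ⟩
    sum (λ y → sum λ x → 𝟙 (lookup B y ∧ lookup A x ∧ adj G y x)) ≡⟨ ≡.sym (E-pairs B A) ⟩
    E B A                                                      ∎
    where
    open ≡-Reasoning
    swap : ∀ x y → lookup A x ∧ lookup B y ∧ adj G x y ≡ lookup B y ∧ lookup A x ∧ adj G y x
    swap x y rewrite Graph.sym G y x = ∧-swap (lookup A x) (lookup B y) _

  handshake : ∀ V → 2 * e G V ≡ E V V
  handshake V = begin
    e G V + (e G V + 0)                ≡⟨ cong (e G V +_) (ℕ.+-identityʳ (e G V)) ⟩
    e G V + e G V                      ≡⟨ cong₂ _+_ e≡S e≡S ⟩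
    S + S                              ≡⟨ cong (S +_) (∑-comm {n} {n} below) ⟩
    S + sum (λ x → sum λ y → below y x) ≡⟨ ≡.sym (∑-distrib-+ {n} _ _) ⟩
    sum (λ x → sum (below x) + sum (λ y → below y x))
                                       ≡⟨ sum-cong-≗ {n} (λ x → ≡.sym (∑-distrib-+ {n} (below x) (λ y → below y x))) ⟩
    sum (λ x → sum λ y → below x y + below y x)
                                       ≡⟨ sum-cong-≗ (λ x → sum-cong-≗ λ y → orient x y) ⟩
    sum (λ x → sum λ y → 𝟙 (lookup V x ∧ lookup V y ∧ adj G x y))
                                       ≡⟨ ≡.sym (E-pairs V V) ⟩
    E V V                              ∎
    where
    open ≡-Reasoning
    below : Fin n → Fin n → ℕ
    below x y = 𝟙 (lookup V x ∧ lookup V y ∧ adj G x y ∧ ⌊ toℕ x <? toℕ y ⌋)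
    S : ℕ
    S = sum λ x → sum (below x)
    e≡S : e G V ≡ S
    e≡S = trans (listSum-allFin (λ x → ListSum.sum (List.map (below x) (List.allFin n)))) (sum-cong-≗ λ x → listSum-allFin (below x))
    orient : ∀ x y → below x y + below y x ≡ 𝟙 (lookup V x ∧ lookup V y ∧ adj G x y)
    orient x y rewrite Graph.sym G y x =
      𝟙-orient (lookup V x) (lookup V y) (adj G x y) _ _
        (λ xy → <-exactlyOne (toℕ x) (toℕ y) (Adj⇒≢ xy ∘ toℕ-injective))

module LowDegree {n : ℕ} (G : Graph n) (d : ℕ)
  (no-short-cycle : ∀ v → deg G v < d → ¬ OnTriangle G v × ¬ OnC4 G v)
  (far-apart : ∀ u v → u ≢ v → deg G u < d → deg G v < d → DistAtLeast G 5 u v)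
  where

  Low : Subset n
  Low = tabulate λ x → ⌊ deg G x <? d ⌋

  ∈Low⁻ : ∀ {x} → x ∈ Low → deg G x < d
  ∈Low⁻ x∈Low = toWitness (T-≡ .from (∈-tabulate⁻ x∈Low))

  ∉Low⁻ : ∀ {x} → x ∉ Low → d ≤ deg G x
  ∉Low⁻ x∉Low = ℕ.≮⇒≥ λ x<d → x∉Low (∈-tabulate⁺ (T-≡ .to (fromWitness x<d)))

  apart : ∀ {x y} → x ∈ Low → y ∈ Low → x ≢ y → ∀ {j} {j<5 : True (j <? 5)} → ¬ Walk G j x y
  apart {x} {y} x∈Low y∈Low x≢y {j} {j<5} =
    far-apart x y x≢y (∈Low⁻ x∈Low) (∈Low⁻ y∈Low) j (toWitness j<5)

  Low-independent : ∀ {x y} → x ∈ Low → y ∈ Low → ¬ Adj G x y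
  Low-independent x∈Low y∈Low xy = apart x∈Low y∈Low (Adj⇒≢ G xy) (step xy here)

  Low-nbr-unique : ∀ {v x y} → x ∈ Low → y ∈ Low → Adj G v x → Adj G v y → x ≡ y
  Low-nbr-unique {v} {x} {y} x∈Low y∈Low vx vy with x Fin.≟ y
  ... | yes x≡y = x≡y
  ... | no  x≢y = ⊥-elim (apart x∈Low y∈Low x≢y (step (Adj-sym G vx) (step vy here)))

  NearLow : Fin n → Set
  NearLow y = y ∈ Low ⊎ ∃[ w ] (w ∈ Low × Adj G w y)

  -- A low vertex and a vertex near another low one cannot share a neighbour:
  -- that would give a triangle at a low vertex or two low vertices at distance ≤ 3.
  low-near-no-common-nbr : ∀ {v y₁ y₂} → Adj G v y₁ → Adj G v y₂ →
                           y₁ ∈ Low → ∃[ w ] (w ∈ Low × Adj G w y₂) → ⊥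
  low-near-no-common-nbr {v} {y₁} {y₂} vy₁ vy₂ y₁∈Low (w , w∈Low , wy₂) with y₁ Fin.≟ w
  ... | yes refl = proj₁ (no-short-cycle y₁ (∈Low⁻ y₁∈Low)) (v , y₂ , Adj-sym G vy₁ , vy₂ , Adj-sym G wy₂)
  ... | no  y₁≢w = apart y₁∈Low w∈Low y₁≢w (step (Adj-sym G vy₁) (step vy₂ (step (Adj-sym G wy₂) here)))

  -- A vertex of degree ≥ d has at most one neighbour near a low vertex: two such
  -- neighbours give a 4-cycle through a low vertex or two low vertices at distance ≤ 4.
  high-nearLow-nbr-unique : ∀ {v y₁ y₂} → v ∉ Low → Adj G v y₁ → Adj G v y₂ →
                            NearLow y₁ → NearLow y₂ → y₁ ≡ y₂
  high-nearLow-nbr-unique {v} {y₁} {y₂} v∉Low vy₁ vy₂ near₁ near₂ with y₁ Fin.≟ y₂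
  ... | yes y₁≡y₂ = y₁≡y₂
  ... | no  y₁≢y₂ = ⊥-elim (clash near₁ near₂)
    where
    clash : NearLow y₁ → NearLow y₂ → ⊥
    clash (inj₁ y₁∈Low) (inj₁ y₂∈Low) = apart y₁∈Low y₂∈Low y₁≢y₂ (step (Adj-sym G vy₁) (step vy₂ here))
    clash (inj₁ y₁∈Low) (inj₂ w₂)     = low-near-no-common-nbr vy₁ vy₂ y₁∈Low w₂
    clash (inj₂ w₁)     (inj₁ y₂∈Low) = low-near-no-common-nbr vy₂ vy₁ y₂∈Low w₁
    clash (inj₂ (w₁ , w₁∈Low , w₁y₁)) (inj₂ (w₂ , w₂∈Low , w₂y₂)) with w₁ Fin.≟ w₂
    ... | yes refl = proj₂ (no-short-cycle w₁ (∈Low⁻ w₁∈Low))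
            (y₁ , v , y₂ , w₁y₁ , Adj-sym G vy₁ , vy₂ , Adj-sym G w₂y₂ , (λ { refl → v∉Low w₁∈Low }) , y₁≢y₂)
    ... | no  w₁≢w₂ = apart w₁∈Low w₂∈Low w₁≢w₂
            (step w₁y₁ (step (Adj-sym G vy₁) (step vy₂ (step (Adj-sym G w₂y₂) here))))

module AroundU {n : ℕ} (G : Graph n) (d : ℕ)
  (min-deg : MinDegAtLeast G 2)
  (no-short-cycle : ∀ v → deg G v < d → ¬ OnTriangle G v × ¬ OnC4 G v)
  (far-apart : ∀ u v → u ≢ v → deg G u < d → deg G v < d → DistAtLeast G 5 u v)
  (U : Subset n)
  where
  open LowDegree G d no-short-cycle far-apart

  X L B NL Y : Subset n
  X  = closedN G U
  L  = U ∩ Low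
  B  = U ∩ ∁ Low
  NL = N G L
  Y  = B ∪ (N G U ∩ ∁ NL)

  ∣L∣+∣B∣≡∣U∣ : ∣ L ∣ + ∣ B ∣ ≡ ∣ U ∣
  ∣L∣+∣B∣≡∣U∣ = ∣p∩q∣+∣p∩∁q∣≡∣p∣ U Low

  -- Vertices of U have all their (≥ 2) neighbours in X and vertices of N(U) at least one,
  -- so Σ_{x∈X} deg_X(x) ≥ 2|U| + |N(U)|.
  E-X : 2 * ∣ U ∣ + ∣ N G U ∣ ≤ E G X X
  E-X = begin
    2 * ∣ U ∣ + ∣ N G U ∣         ≡⟨ cong (2 * ∣ U ∣ +_) (≡.sym (ℕ.*-identityˡ _)) ⟩
    2 * ∣ U ∣ + 1 * ∣ N G U ∣     ≤⟨ ℕ.+-mono-≤ from-U from-N ⟩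
    E G U X + E G (N G U) X      ≡⟨ ≡.sym (E-∪ˡ G X (U#N G U)) ⟩
    E G X X                      ∎
    where
    open ℕ.≤-Reasoning
    from-U : 2 * ∣ U ∣ ≤ E G U X
    from-U = E-lower G 2 0 {U} {X} λ x∈U → ℕ.≤-trans (min-deg _) (deg≤degIn G {B = X} (nbr∈closedN G x∈U))
    from-N : 1 * ∣ N G U ∣ ≤ E G (N G U) X
    from-N = E-lower G 1 0 {N G U} {X} λ x∈N →
      let (_ , w , w∈U , wx) = ∈N⁻ G x∈N in 1≤degIn G {B = X} (x∈p∪q⁺ (inj₁ w∈U)) (Adj-sym G wx)

  L⊆U : L ⊆ U
  L⊆U = proj₁ ∘ x∈p∩q⁻ U Low

  L⊆Low : L ⊆ Low
  L⊆Low = proj₂ ∘ x∈p∩q⁻ U Low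

  B⊆Y : B ⊆ Y
  B⊆Y y∈B = x∈p∪q⁺ (inj₁ y∈B)

  Y⊆X : Y ⊆ X
  Y⊆X y∈Y with x∈p∪q⁻ B _ y∈Y
  ... | inj₁ y∈B = x∈p∪q⁺ (inj₁ (proj₁ (x∈p∩q⁻ U (∁ Low) y∈B)))
  ... | inj₂ y∈N = x∈p∪q⁺ (inj₂ (proj₁ (x∈p∩q⁻ (N G U) (∁ NL) y∈N)))

  -- Since L is independent, all neighbours of a vertex of L lie in N(L).
  nbr-of-L∈NL : ∀ {x y} → x ∈ L → Adj G x y → y ∈ NL
  nbr-of-L∈NL x∈L xy = ∈N⁺ G x∈L xy λ y∈L → Low-independent (L⊆Low x∈L) (L⊆Low y∈L) xy

  -- Each vertex of L has ≥ 2 neighbours, all in N(L), and each vertex of N(L) has only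
  -- one neighbour in L; double counting the L–N(L) edges gives 2|L| ≤ |N(L)|.
  2∣L∣≤∣NL∣ : 2 * ∣ L ∣ ≤ ∣ NL ∣
  2∣L∣≤∣NL∣ = begin
    2 * ∣ L ∣      ≤⟨ E-lower G 2 0 {L} {NL} (λ {x} x∈L →
                        ℕ.≤-trans (min-deg x) (deg≤degIn G {B = NL} (nbr-of-L∈NL x∈L))) ⟩
    E G L NL       ≡⟨ E-sym G L NL ⟩
    E G NL L       ≤⟨ E-upper G 1 {NL} {L} (λ _ → degIn≤1 G {B = L} λ y∈L z∈L xy xz →
                        Low-nbr-unique (L⊆Low y∈L) (L⊆Low z∈L) xy xz) ⟩
    1 * ∣ NL ∣     ≡⟨ ℕ.*-identityˡ ∣ NL ∣ ⟩
    ∣ NL ∣         ∎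
    where open ℕ.≤-Reasoning

  -- N(L) lies in X but avoids L, so it is covered by N(U) ∩ N(L) and B.
  ∣NL∣≤ : ∣ NL ∣ ≤ ∣ N G U ∩ NL ∣ + ∣ B ∣
  ∣NL∣≤ = ℕ.≤-trans (p⊆q⇒∣p∣≤∣q∣ NL⊆) (∣p∪q∣≤∣p∣+∣q∣ (N G U ∩ NL) B)
    where
    NL⊆ : NL ⊆ (N G U ∩ NL) ∪ B
    NL⊆ {y} y∈NL with ∈N⁻ G y∈NL
    ... | y∉L , w , w∈L , wy with x∈p∪q⁻ U (N G U) (nbr∈closedN G (L⊆U w∈L) wy)
    ...   | inj₂ y∈N = x∈p∪q⁺ (inj₁ (x∈p∩q⁺ (y∈N , y∈NL)))
    ...   | inj₁ y∈U = x∈p∪q⁺ (inj₂ (x∈p∩q⁺ (y∈U , x∉p⇒x∈∁p λ y∈Low → y∉L (x∈p∩q⁺ (y∈U , y∈Low)))))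

  ∣Y∣+∣N∩NL∣≡ : ∣ Y ∣ + ∣ N G U ∩ NL ∣ ≡ ∣ B ∣ + ∣ N G U ∣
  ∣Y∣+∣N∩NL∣≡ = begin
    ∣ Y ∣ + ∣ N G U ∩ NL ∣                                ≡⟨ cong (_+ ∣ N G U ∩ NL ∣) ∣Y∣≡ ⟩
    ∣ B ∣ + ∣ N G U ∩ ∁ NL ∣ + ∣ N G U ∩ NL ∣              ≡⟨ ℕ.+-assoc ∣ B ∣ _ _ ⟩
    ∣ B ∣ + (∣ N G U ∩ ∁ NL ∣ + ∣ N G U ∩ NL ∣)            ≡⟨ cong (∣ B ∣ +_) (ℕ.+-comm ∣ N G U ∩ ∁ NL ∣ _) ⟩
    ∣ B ∣ + (∣ N G U ∩ NL ∣ + ∣ N G U ∩ ∁ NL ∣)            ≡⟨ cong (∣ B ∣ +_) (∣p∩q∣+∣p∩∁q∣≡∣p∣ (N G U) NL) ⟩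
    ∣ B ∣ + ∣ N G U ∣                                     ∎
    where
    open ≡-Reasoning
    ∣Y∣≡ : ∣ Y ∣ ≡ ∣ B ∣ + ∣ N G U ∩ ∁ NL ∣
    ∣Y∣≡ = ∣p∪q∣≡∣p∣+∣q∣ B _ λ y∈B y∈N →
      U#N G U (proj₁ (x∈p∩q⁻ U (∁ Low) y∈B)) (proj₁ (x∈p∩q⁻ (N G U) (∁ NL) y∈N))

  -- A high vertex of U has all neighbours in Y except at most one, which is low or
  -- adjacent to a low vertex; hence d|B| ≤ |B| + Σ_{x∈Y} deg_Y(x).
  B-degrees : d * ∣ B ∣ ≤ 1 * ∣ B ∣ + E G Y Y
  B-degrees = ℕ.≤-trans (E-lower G d 1 {B} {Y} high-bound) (ℕ.+-monoʳ-≤ (1 * ∣ B ∣) (E-monoˡ G {B} {Y} {Y} B⊆Y))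
    where
    Bad : Subset n
    Bad = L ∪ NL
    near : ∀ {y} → y ∈ Bad → NearLow y
    near y∈Bad with x∈p∪q⁻ L NL y∈Bad
    ... | inj₁ y∈L  = inj₁ (L⊆Low y∈L)
    ... | inj₂ y∈NL = let (_ , w , w∈L , wy) = ∈N⁻ G y∈NL in inj₂ (w , L⊆Low w∈L , wy)
    covered : ∀ {x y} → x ∈ U → Adj G x y → y ∈ Bad ⊎ y ∈ Y
    covered x∈U xy with x∈p∪q⁻ U (N G U) (nbr∈closedN G x∈U xy)
    covered {y = y} _ _ | inj₁ y∈U with y ∈? Low
    ... | yes y∈Low = inj₁ (x∈p∪q⁺ (inj₁ (x∈p∩q⁺ (y∈U , y∈Low))))
    ... | no  y∉Low = inj₂ (B⊆Y (x∈p∩q⁺ (y∈U , x∉p⇒x∈∁p y∉Low)))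
    covered {y = y} _ _ | inj₂ y∈N with y ∈? NL
    ... | yes y∈NL = inj₁ (x∈p∪q⁺ (inj₂ y∈NL))
    ... | no  y∉NL = inj₂ (x∈p∪q⁺ (inj₂ (x∈p∩q⁺ (y∈N , x∉p⇒x∈∁p y∉NL))))
    high-bound : ∀ {x} → x ∈ B → d ≤ 1 + degIn G x Y
    high-bound {x} x∈B = begin
      d                               ≤⟨ ∉Low⁻ x∉Low ⟩
      deg G x                         ≤⟨ deg≤degIn+degIn G {B = Bad} {Y} (covered x∈U) ⟩
      degIn G x Bad + degIn G x Y     ≤⟨ ℕ.+-monoˡ-≤ (degIn G x Y) (degIn≤1 G {B = Bad} λ y∈ z∈ xy xz →
                                           high-nearLow-nbr-unique x∉Low xy xz (near y∈) (near z∈)) ⟩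
      1 + degIn G x Y                 ∎
      where
      open ℕ.≤-Reasoning
      x∈U : x ∈ U
      x∈U = proj₁ (x∈p∩q⁻ U (∁ Low) x∈B)
      x∉Low : x ∉ Low
      x∉Low = x∈∁p⇒x∉p (proj₂ (x∈p∩q⁻ U (∁ Low) x∈B))

-- Case d ≤ 5: the degree sum 2u + n over X = U ∪ N(U) exceeds what sparseness allows.
dense-contradiction : ∀ d u n E → d ≤ 5 → n < 2 * u → 2 * u + n ≤ E → 5 * E ≤ d * (u + n) → ⊥
dense-contradiction d u n E d≤5 shrinks degrees sparse = nonempty u shrinks 5u≤0
  where
  open ℕ.≤-Reasoning
  regroup : ∀ u n → 5 * u + 5 * (u + n) ≡ 5 * (2 * u + n)
  regroup = solve-∀
  5u≤0 : 5 * u ≤ 0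
  5u≤0 = ℕ.+-cancelʳ-≤ (5 * (u + n)) (5 * u) 0 (begin
    5 * u + 5 * (u + n)   ≡⟨ regroup u n ⟩
    5 * (2 * u + n)       ≤⟨ ℕ.*-monoʳ-≤ 5 degrees ⟩
    5 * E                 ≤⟨ sparse ⟩
    d * (u + n)           ≤⟨ ℕ.*-monoˡ-≤ (u + n) d≤5 ⟩
    5 * (u + n)           ∎)
  nonempty : ∀ u → n < 2 * u → 5 * u ≤ 0 → ⊥
  nonempty zero    ()
  nonempty (suc u) _  ()

-- Case d ≥ 5: with b, l = |B|, |L|, n = |N(U)|, y = |Y|, p = |N(U) ∩ N(L)| and
-- EY = Σ_{x∈Y} deg_Y(x), the bounds of the proof force d·b + d ≤ 5b.
sparse-contradiction : ∀ d b l n y p EY → 5 ≤ d →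
  d * b ≤ 1 * b + EY → 5 * EY ≤ d * y → 2 * l ≤ p + b → y + p ≡ b + n → n < 2 * (l + b) → ⊥
sparse-contradiction d b l n y p EY 5≤d high-degrees sparse 2l≤p+b sizes shrinks =
  ℕ.m+1+n≰m (5 * b) (begin
    5 * b + 5   ≤⟨ ℕ.+-mono-≤ (ℕ.*-monoˡ-≤ b 5≤d) 5≤d ⟩
    d * b + d   ≤⟨ ℕ.+-cancelʳ-≤ _ (d * b + d) (5 * b) combined ⟩
    5 * b       ∎)
  where
  open ℕ.≤-Reasoning
  expand : ∀ b EY → 5 * (1 * b + EY) ≡ 5 * b + 5 * EY
  expand = solve-∀
  collect : ∀ b n → b + n + b ≡ 2 * b + n
  collect = solve-∀
  left-form : ∀ d b y l n → d * b + d + (4 * (d * b) + d * y + 2 * (d * l) + d * n) ≡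
                            5 * (d * b) + d * (y + 2 * l) + d * suc n
  left-form = solve-∀
  right-form : ∀ d b y l n → 5 * b + d * y + d * (2 * b + n) + d * (2 * (l + b)) ≡
                             5 * b + (4 * (d * b) + d * y + 2 * (d * l) + d * n)
  right-form = solve-∀
  degrees : 5 * (d * b) ≤ 5 * b + d * y
  degrees = begin
    5 * (d * b)         ≤⟨ ℕ.*-monoʳ-≤ 5 high-degrees ⟩
    5 * (1 * b + EY)    ≡⟨ expand b EY ⟩
    5 * b + 5 * EY      ≤⟨ ℕ.+-monoʳ-≤ (5 * b) sparse ⟩
    5 * b + d * y       ∎
  size-of-Y : y + 2 * l ≤ 2 * b + n
  size-of-Y = begin
    y + 2 * l           ≤⟨ ℕ.+-monoʳ-≤ y 2l≤p+b ⟩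
    y + (p + b)         ≡⟨ ℕ.+-assoc y p b ⟨
    y + p + b           ≡⟨ cong (_+ b) sizes ⟩
    b + n + b           ≡⟨ collect b n ⟩
    2 * b + n           ∎
  -- adding d times the two size bounds to the degree bound
  combined : d * b + d + (4 * (d * b) + d * y + 2 * (d * l) + d * n) ≤
             5 * b + (4 * (d * b) + d * y + 2 * (d * l) + d * n)
  combined = begin
    d * b + d + (4 * (d * b) + d * y + 2 * (d * l) + d * n)     ≡⟨ left-form d b y l n ⟩
    5 * (d * b) + d * (y + 2 * l) + d * suc n                  ≤⟨ ℕ.+-mono-≤ (ℕ.+-mono-≤ degrees
                                                                    (ℕ.*-monoʳ-≤ d size-of-Y)) (ℕ.*-monoʳ-≤ d shrinks) ⟩
    5 * b + d * y + d * (2 * b + n) + d * (2 * (l + b))        ≡⟨ right-form d b y l n ⟩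
    5 * b + (4 * (d * b) + d * y + 2 * (d * l) + d * n)         ∎

-- Large case: at least m vertices lie outside U ∪ N(U).
room-outside : ∀ h m u n → m ≤ u → n < 2 * u → 4 * u ≤ h → m ≤ h ∸ (u + n)
room-outside h m u n m≤u shrinks 4u≤h = ℕ.m+n≤o⇒m≤o∸n m (begin
  m + (u + n)       ≤⟨ ℕ.+-mono-≤ m≤u (ℕ.+-monoʳ-≤ u (ℕ.<⇒≤ shrinks)) ⟩
  u + (u + 2 * u)   ≡⟨ four u ⟩
  4 * u             ≤⟨ 4u≤h ⟩
  h                 ∎)
  where
  open ℕ.≤-Reasoning
  four : ∀ u → u + (u + 2 * u) ≡ 4 * u
  four = solve-∀

-- Small case: U ∪ N(U) has at most 5m vertices.
small-closure : ∀ m u n → u < m → n < 2 * u → u + n ≤ 5 * m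
small-closure m u n u<m shrinks = begin
  u + n         ≤⟨ ℕ.+-monoʳ-≤ u (ℕ.<⇒≤ shrinks) ⟩
  u + 2 * u     ≡⟨ three u ⟩
  3 * u         ≤⟨ ℕ.*-monoʳ-≤ 3 (ℕ.<⇒≤ u<m) ⟩
  3 * m         ≤⟨ ℕ.*-monoˡ-≤ m (ℕ.m≤m+n 3 2) ⟩
  5 * m         ∎
  where
  open ℕ.≤-Reasoning
  three : ∀ u → u + 2 * u ≡ 3 * u
  three = solve-∀

-- Condition 4 makes every set of ≥ m vertices with |U| ≤ h/4 expand: otherwise
-- m vertices of U and m vertices outside U ∪ N(U) would span no edge.
large-sets-expand : ∀ {h} (G : Graph h) m →
  (∀ (U₁ U₂ : Subset h) → (∀ x → x ∈ U₁ → x ∉ U₂) → ∣ U₁ ∣ ≡ m → ∣ U₂ ∣ ≡ m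
     → ∃[ u ] ∃[ v ] (u ∈ U₁ × v ∈ U₂ × Adj G u v)) →
  ∀ U → m ≤ ∣ U ∣ → 4 * ∣ U ∣ ≤ h → ∣ N G U ∣ < 2 * ∣ U ∣ → ⊥
large-sets-expand {h} G m linked U large 4∣U∣≤h shrinks =
  let (U₁ , U₁⊆U , ∣U₁∣≡m) = subsetOfSize U m large
      (U₂ , U₂⊆W , ∣U₂∣≡m) = subsetOfSize W m m≤∣W∣
      (u , v , u∈U₁ , v∈U₂ , uv) = linked U₁ U₂ (λ x x∈U₁ x∈U₂ → ∉closedN (U₂⊆W x∈U₂) (x∈p∪q⁺ (inj₁ (U₁⊆U x∈U₁))))
                                     ∣U₁∣≡m ∣U₂∣≡m
  in ∉closedN (U₂⊆W v∈U₂) (nbr∈closedN G (U₁⊆U u∈U₁) uv)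
  where
  W : Subset h
  W = ∁ (closedN G U)
  ∉closedN : ∀ {x} → x ∈ W → x ∉ closedN G U
  ∉closedN = x∈∁p⇒x∉p
  m≤∣W∣ : m ≤ ∣ W ∣
  m≤∣W∣ = subst (m ≤_) (≡.sym (trans (∣∁p∣≡n∸∣p∣ (closedN G U)) (cong (h ∸_) (∣closedN∣ G U))))
            (room-outside h m (∣ U ∣) (∣ N G U ∣) large shrinks 4∣U∣≤h)

small-sets-expand : ∀ {h} (G : Graph h) m d →
  MinDegAtLeast G 2 →
  (∀ v → deg G v < d → ¬ OnTriangle G v × ¬ OnC4 G v) →
  (∀ u v → u ≢ v → deg G u < d → deg G v < d → DistAtLeast G 5 u v) →
  (∀ (V : Subset h) → ∣ V ∣ ≤ 5 * m → 10 * e G V ≤ d * ∣ V ∣) →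
  ∀ U → ∣ U ∣ < m → ∣ N G U ∣ < 2 * ∣ U ∣ → ⊥
small-sets-expand G m d min-deg no-short-cycle far-apart sparse U small shrinks =
  case d ≤? 5 of λ where
    (yes d≤5) → dense-contradiction d (∣ U ∣) (∣ N G U ∣) (E G X X) d≤5 shrinks E-X
                  (subst (λ s → 5 * E G X X ≤ d * s) (∣closedN∣ G U) (sparse′ X ∣X∣≤5m))
    (no  d≰5) → sparse-contradiction d (∣ B ∣) (∣ L ∣) (∣ N G U ∣) (∣ Y ∣) (∣ N G U ∩ NL ∣) (E G Y Y)
                  (ℕ.<⇒≤ (ℕ.≰⇒> d≰5)) B-degrees (sparse′ Y (ℕ.≤-trans (p⊆q⇒∣p∣≤∣q∣ Y⊆X) ∣X∣≤5m))
                  (ℕ.≤-trans 2∣L∣≤∣NL∣ ∣NL∣≤) ∣Y∣+∣N∩NL∣≡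
                  (subst (λ u → ∣ N G U ∣ < 2 * u) (≡.sym ∣L∣+∣B∣≡∣U∣) shrinks)
  where
  open AroundU G d min-deg no-short-cycle far-apart U
  sparse′ : ∀ V → ∣ V ∣ ≤ 5 * m → 5 * E G V V ≤ d * ∣ V ∣
  sparse′ V V-small = subst (_≤ d * ∣ V ∣) (trans (ℕ.*-assoc 5 2 (e G V)) (cong (5 *_) (handshake G V)))
                        (sparse V V-small)
  ∣X∣≤5m : ∣ X ∣ ≤ 5 * m
  ∣X∣≤5m = subst (_≤ 5 * m) (≡.sym (∣closedN∣ G U)) (small-closure m (∣ U ∣) (∣ N G U ∣) small shrinks)

lemma4p6 : (m d h : ℕ) → 1 ≤ m → 1 ≤ d → 4 * m ≤ h → (H : Graph h)
    → MinDegAtLeast H 2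
    → (∀ v → deg H v < d → ¬ OnTriangle H v × ¬ OnC4 H v)
    → (∀ u v → u ≢ v → deg H u < d → deg H v < d → DistAtLeast H 5 u v)
    → (∀ (U : Subset h) → ∣ U ∣ ≤ 5 * m → 10 * e H U ≤ d * ∣ U ∣)
    → (∀ (U₁ U₂ : Subset h) → (∀ x → x ∈ U₁ → x ∉ U₂) → ∣ U₁ ∣ ≡ m → ∣ U₂ ∣ ≡ m
         → ∃[ u ] ∃[ v ] (u ∈ U₁ × v ∈ U₂ × Adj H u v))
    → IsExpander H h 4 2
-- Either U expands, or it shrinks and the large or small case applies.
lemma4p6 m d h _ _ _ H min-deg no-short-cycle far-apart sparse linked U 4∣U∣≤h
  with 2 * ∣ U ∣ ≤? ∣ N H U ∣
... | yes expands = expands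
... | no  ¬expands = ⊥-elim (case m ≤? ∣ U ∣ of λ where
    (yes large) → large-sets-expand H m linked U large 4∣U∣≤h shrinks
    (no  small) → small-sets-expand H m d min-deg no-short-cycle far-apart sparse U (ℕ.≰⇒> small) shrinks)
  where
  shrinks : ∣ N H U ∣ < 2 * ∣ U ∣
  shrinks = ℕ.≰⇒> ¬expands
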